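{- Let $n\ge2$, let $a_0,\ldots,a_{n-1}\ge0$ be integers, not all zero, $k=\sum a_i$, and let $A\in\mathbf{\Pi}_\lambda$. Then for all $i,j\in\mathbb Z$ one has $s_{i,j}(A)\ge s_{i+1,j}(A)\ge s_{i,j+1}(A)$, i.e. $(s_{i,j}(A))_{i,j\in\mathbb Z}$ is a plane-filling Gelfand–Tsetlin pattern.
   Context: Indices of the $a_i$ are read modulo $n$. For $m\in\mathbb Z$, $T^m$ is the two-sided sequence with $T^m_i=0$ for $i>mn$ and $T^m_i=a_{i\bmod n}$ for $i\le mn$. $\mathbf{\Pi}_\lambda$ is the set of two-sided integer sequences $A=(A_i)_{i\in\mathbb Z}$ with $A_i=0$ for $i\gg0$, $A_i=a_{i\bmod n}$ for $i\ll0$, and $A_i\ge0$, $A_{i-n+1}+\cdots+A_i\le k$ for all $i$. For such $A$, $s_{i,j}(A)=\sum_{l\le in+j(n-1)}(A_l-T^{i+j}_l)-\sum_{l=in+j(n-1)+1}^{(i+j)n}T^{i+j}_l$. -}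

module Defs where

open import Data.Nat as ℕ using (ℕ; zero; suc; NonZero)
open import Data.Fin using (Fin; fromℕ<)
import Data.Fin as F
open import Data.Integer using (ℤ; +_; _+_; _-_; _*_; _≤_; _<_; _⊔_; _⊓_; ∣_∣; _%ℕ_; 0ℤ; 1ℤ)
open import Data.Integer.DivMod using (n%ℕd<d)
open import Data.Integer.Properties using (_≤?_)
open import Data.Bool using (if_then_else_)
open import Relation.Nullary using (does)
open import Relation.Binary.PropositionalEquality using (_≡_)

finSum : ∀ {n} → (Fin n → ℕ) → ℕ
finSum {zero}  f = 0
finSum {suc n} f = f F.zero ℕ.+ finSum (λ t → f (F.suc t))

sumFrom : (ℤ → ℤ) → ℤ → ℕ → ℤ
sumFrom f lo zero    = 0ℤ
sumFrom f lo (suc m) = f lo + sumFrom f (lo + 1ℤ) m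

-- Σ_{l = lo}^{hi} f l  (empty, i.e. 0, when hi < lo)
intervalSum : (ℤ → ℤ) → ℤ → ℤ → ℤ
intervalSum f lo hi = sumFrom f lo ∣ (hi - lo + 1ℤ) ⊔ 0ℤ ∣

module _ (n : ℕ) .{{_ : NonZero n}} (a : Fin n → ℕ) where

  aAt : ℤ → ℤ
  aAt i = + a (fromℕ< (n%ℕd<d i n))

  kk : ℕ
  kk = finSum a

  T : ℤ → ℤ → ℤ
  T m l = if does (l ≤? m * + n) then aAt l else 0ℤ

  -- membership A ∈ Π_λ; the fields `lower`/`upper` witness "i ≪ 0" / "i ≫ 0"
  record InΠ (A : ℤ → ℤ) : Set where
    field
      lower   : ℤ
      below   : ∀ l → l < lower → A l ≡ aAt l
      upper   : ℤ
      above   : ∀ l → upper < l → A l ≡ 0ℤ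
      nonneg  : ∀ l → 0ℤ ≤ A l
      window  : ∀ l → intervalSum A (l - + n + 1ℤ) l ≤ + kk

  -- s_{i,j}(A) = Σ_{l ≤ in + j(n-1)} (A_l - T^{i+j}_l) - Σ_{l=in+j(n-1)+1}^{(i+j)n} T^{i+j}_l.
  -- The first (formally infinite) sum is truncated below at
  -- lower ⊓ (i+j) n, below which every term A_l - T^{i+j}_l is 0.
  s : ∀ {A} → InΠ A → ℤ → ℤ → ℤ
  s {A} h i j =
      intervalSum (λ l → A l - T (i + j) l) (InΠ.lower h ⊓ ((i + j) * + n)) p
    - intervalSum (T (i + j)) (p + 1ℤ) ((i + j) * + n)
    where
      p : ℤ
      p = i * + n + j * (+ n - 1ℤ)

module Submission where

-- Write p = in + j(n-1) and M = (i+j)n.  The formally infinite sum in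
-- s_{i,j} has vanishing terms far to the left, so for every b below the
-- lower witness of A, below M and below p+1, s_{i,j} is a difference of two
-- finite partial sums started at b:
--     s_{i,j} = Σ_{b ≤ l ≤ p} A_l - Σ_{b ≤ l ≤ M} a_{l mod n}      (s-normal).
-- Passing from (i,j) to (i+1,j) moves both p and M by n: the A-sum gains a
-- window of n consecutive entries (at most k) and the periodic sum gains a
-- full period (exactly k), so s does not increase.  Passing from (i,j+1) to
-- (i+1,j) keeps M and moves p by one: s gains the entry A_{p+1} ≥ 0.

open import Defs
open import Data.Nat as ℕ using (ℕ; NonZero; suc)
open import Data.Fin using (Fin; fromℕ<; toℕ)
import Data.Fin.Properties as FP
import Data.Nat.Properties as NP
open import Data.Integer
  using (ℤ; _≥_; _+_; 1ℤ; +_; _-_; _*_; _≤_; _<_; _⊔_; _⊓_; ∣_∣; 0ℤ; +≤+; _%ℕ_; _/ℕ_)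
open import Data.Integer.Properties
open import Data.Integer.DivMod using (n%ℕd<d; a≡a%ℕn+[a/ℕn]*n)
open import Data.Integer.Tactic.RingSolver using (solve-∀)
open import Data.Product using (Σ; _×_; _,_)
open import Data.Sum using (inj₁; inj₂)
open import Data.Empty using (⊥-elim)
open import Relation.Nullary using (¬_; yes; no)
open import Relation.Binary.Definitions using (tri<; tri≈; tri>)
open import Relation.Binary.PropositionalEquality
open ≡-Reasoning

≤⇒gap : ∀ {x y} → x ≤ y → Σ ℕ λ d → y ≡ x + + d
≤⇒gap {x} {y} x≤y = ∣ y - x ∣ , (begin
  y                ≡⟨ sym (x+[y-x]≡y x y) ⟩
  x + (y - x)      ≡⟨ cong (λ z → x + z) (sym (0≤i⇒+∣i∣≡i (i≤j⇒0≤j-i x≤y))) ⟩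
  x + + ∣ y - x ∣  ∎)
  where
  x+[y-x]≡y : ∀ x y → x + (y - x) ≡ y
  x+[y-x]≡y = solve-∀

<⇒+1≤ : ∀ {x y} → x < y → x + 1ℤ ≤ y
<⇒+1≤ {x} x<y = subst (_≤ _) (+-comm 1ℤ x) (i<j⇒suc[i]≤j x<y)

+1≤⇒< : ∀ {x y} → x + 1ℤ ≤ y → x < y
+1≤⇒< {x} x+1≤y = suc[i]≤j⇒i<j (subst (_≤ _) (+-comm x 1ℤ) x+1≤y)

+1-cancel-≤ : ∀ {x y} → x + 1ℤ ≤ y + 1ℤ → x ≤ y
+1-cancel-≤ {x} {y} x+1≤y+1 =
  subst₂ _≤_ (x+1-1≡x x) (x+1-1≡x y) (+-monoˡ-≤ (0ℤ - 1ℤ) x+1≤y+1)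
  where
  x+1-1≡x : ∀ x → x + 1ℤ + (0ℤ - 1ℤ) ≡ x
  x+1-1≡x = solve-∀

sumFrom-split : ∀ f lo a b →
  sumFrom f lo (a ℕ.+ b) ≡ sumFrom f lo a + sumFrom f (lo + + a) b
sumFrom-split f lo 0       b =
  trans (cong (λ z → sumFrom f z b) (sym (+-identityʳ lo))) (sym (+-identityˡ _))
sumFrom-split f lo (suc a) b = begin
  f lo + sumFrom f (lo + 1ℤ) (a ℕ.+ b)
    ≡⟨ cong (λ z → f lo + z) (sumFrom-split f (lo + 1ℤ) a b) ⟩
  f lo + (sumFrom f (lo + 1ℤ) a + sumFrom f (lo + 1ℤ + + a) b)
    ≡⟨ sym (+-assoc (f lo) _ _) ⟩
  f lo + sumFrom f (lo + 1ℤ) a + sumFrom f (lo + 1ℤ + + a) b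
    ≡⟨ cong (λ z → f lo + sumFrom f (lo + 1ℤ) a + sumFrom f z b) (+-assoc lo 1ℤ (+ a)) ⟩
  f lo + sumFrom f (lo + 1ℤ) a + sumFrom f (lo + + suc a) b
    ∎

sumFrom-cong : ∀ f g lo len → (∀ t → t ℕ.< len → f (lo + + t) ≡ g (lo + + t)) →
  sumFrom f lo len ≡ sumFrom g lo len
sumFrom-cong f g lo 0         agree = refl
sumFrom-cong f g lo (suc len) agree = cong₂ _+_ first (sumFrom-cong f g (lo + 1ℤ) len rest)
  where
  first : f lo ≡ g lo
  first = subst (λ z → f z ≡ g z) (+-identityʳ lo) (agree 0 (ℕ.s≤s ℕ.z≤n))
  rest : ∀ t → t ℕ.< len → f (lo + 1ℤ + + t) ≡ g (lo + 1ℤ + + t)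
  rest t t<len = subst (λ z → f z ≡ g z) (sym (+-assoc lo 1ℤ (+ t))) (agree (suc t) (ℕ.s≤s t<len))

sumFrom-zero : ∀ lo len → sumFrom (λ _ → 0ℤ) lo len ≡ 0ℤ
sumFrom-zero lo 0         = refl
sumFrom-zero lo (suc len) = trans (+-identityˡ _) (sumFrom-zero (lo + 1ℤ) len)

sumFrom-sub : ∀ f g lo len →
  sumFrom (λ l → f l - g l) lo len ≡ sumFrom f lo len - sumFrom g lo len
sumFrom-sub f g lo 0         = refl
sumFrom-sub f g lo (suc len) =
  trans (cong (λ z → (f lo - g lo) + z) (sumFrom-sub f g (lo + 1ℤ) len)) (interchange (f lo) (g lo) _ _)
  where
  interchange : ∀ a b c d → (a - b) + (c - d) ≡ (a + c) - (b + d)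
  interchange = solve-∀

sumFrom-finSum : ∀ m (g : Fin m → ℕ) f lo → (∀ t → f (lo + + toℕ t) ≡ + g t) →
  sumFrom f lo m ≡ + finSum g
sumFrom-finSum 0       g f lo matches = refl
sumFrom-finSum (suc m) g f lo matches = cong₂ _+_
  (subst (λ z → f z ≡ + g Data.Fin.zero) (+-identityʳ lo) (matches Data.Fin.zero))
  (sumFrom-finSum m (λ t → g (Data.Fin.suc t)) f (lo + 1ℤ) λ t →
    subst (λ z → f z ≡ + g (Data.Fin.suc t)) (sym (+-assoc lo 1ℤ (+ toℕ t))) (matches (Data.Fin.suc t)))

-- If the term following a run equals its first term, the run shifted by one
-- place has the same sum; this is how sums over a period are moved.
sumFrom-rotate : ∀ f lo len → f (lo + + len) ≡ f lo →
  sumFrom f (lo + 1ℤ) len ≡ sumFrom f lo len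
sumFrom-rotate f lo len wraps = begin
  X                   ≡⟨ add-sub (f lo) X ⟩
  (f lo + X) - f lo   ≡⟨ cong (_- f lo) both-ends ⟩
  (Y + f lo) - f lo   ≡⟨ sub-add (f lo) Y ⟩
  Y                   ∎
  where
  X = sumFrom f (lo + 1ℤ) len
  Y = sumFrom f lo len
  add-sub : ∀ u v → v ≡ (u + v) - u
  add-sub = solve-∀
  sub-add : ∀ u v → (v + u) - u ≡ v
  sub-add = solve-∀
  -- the run of len + 1 terms, split off at either end
  both-ends : f lo + X ≡ Y + f lo
  both-ends = begin
    sumFrom f lo (suc len)            ≡⟨ cong (sumFrom f lo) (NP.+-comm 1 len) ⟩
    sumFrom f lo (len ℕ.+ 1)          ≡⟨ sumFrom-split f lo len 1 ⟩
    Y + (f (lo + + len) + 0ℤ)         ≡⟨ cong (λ z → Y + z) (trans (+-identityʳ _) wraps) ⟩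
    Y + f lo                          ∎

intervalSum-run : ∀ f lo len hi → hi ≡ lo + + len - 1ℤ →
  intervalSum f lo hi ≡ sumFrom f lo len
intervalSum-run f lo len hi hi≡ =
  cong (λ z → sumFrom f lo ∣ z ∣)
    (trans (cong (_⊔ 0ℤ) (trans (cong (λ z → z - lo + 1ℤ) hi≡) (length lo (+ len))))
           (i≥j⇒i⊔j≡i (+≤+ ℕ.z≤n)))
  where
  length : ∀ x y → x + y - 1ℤ - x + 1ℤ ≡ y
  length = solve-∀

intervalSum-asRun : ∀ {lo hi} → lo ≤ hi + 1ℤ → Σ ℕ λ len → hi ≡ lo + + len - 1ℤ
intervalSum-asRun {lo} {hi} lo≤hi+1 with ≤⇒gap lo≤hi+1
... | len , hi+1≡ = len , trans (x≡x+1-1 hi) (cong (_- 1ℤ) hi+1≡)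
  where
  x≡x+1-1 : ∀ x → x ≡ x + 1ℤ - 1ℤ
  x≡x+1-1 = solve-∀

intervalSum-empty : ∀ f lo hi → hi + 1ℤ ≤ lo → intervalSum f lo hi ≡ 0ℤ
intervalSum-empty f lo hi hi<lo =
  cong (λ z → sumFrom f lo ∣ z ∣)
    (i≤j⇒i⊔j≡j (subst (_≤ 0ℤ) (sym (reorder hi lo)) (i≤j⇒i-j≤0 hi<lo)))
  where
  reorder : ∀ h l → h - l + 1ℤ ≡ (h + 1ℤ) - l
  reorder = solve-∀

intervalSum-single : ∀ f x → intervalSum f x x ≡ f x
intervalSum-single f x = trans (intervalSum-run f x 1 x (x≡x+1-1 x)) (+-identityʳ (f x))
  where
  x≡x+1-1 : ∀ x → x ≡ x + 1ℤ - 1ℤ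
  x≡x+1-1 = solve-∀

intervalSum-sub : ∀ f g lo hi →
  intervalSum (λ l → f l - g l) lo hi ≡ intervalSum f lo hi - intervalSum g lo hi
intervalSum-sub f g lo hi = sumFrom-sub f g lo ∣ hi - lo + 1ℤ ⊔ 0ℤ ∣

intervalSum-split : ∀ f lo mid hi → lo ≤ mid + 1ℤ → mid ≤ hi →
  intervalSum f lo hi ≡ intervalSum f lo mid + intervalSum f (mid + 1ℤ) hi
intervalSum-split f lo mid hi lo≤mid+1 mid≤hi
  with intervalSum-asRun lo≤mid+1 | ≤⇒gap mid≤hi
... | a , mid≡ | b , hi≡ = begin
  intervalSum f lo hi
    ≡⟨ intervalSum-run f lo (a ℕ.+ b) hi (trans hi≡ (trans (cong (_+ + b) mid≡) (shift lo (+ a) (+ b)))) ⟩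
  sumFrom f lo (a ℕ.+ b)
    ≡⟨ sumFrom-split f lo a b ⟩
  sumFrom f lo a + sumFrom f (lo + + a) b
    ≡⟨ cong₂ _+_ (sym (intervalSum-run f lo a mid mid≡))
                 (sym (intervalSum-run f (lo + + a) b hi (trans hi≡ (trans (cong (_+ + b) mid≡) (swap lo (+ a) (+ b)))))) ⟩
  intervalSum f lo mid + intervalSum f (lo + + a) hi
    ≡⟨ cong (λ z → intervalSum f lo mid + intervalSum f z hi) (cancel-1 lo (+ a)) ⟩
  intervalSum f lo mid + intervalSum f (lo + + a - 1ℤ + 1ℤ) hi
    ≡⟨ cong (λ z → intervalSum f lo mid + intervalSum f (z + 1ℤ) hi) (sym mid≡) ⟩
  intervalSum f lo mid + intervalSum f (mid + 1ℤ) hi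
    ∎
  where
  shift : ∀ lo a b → lo + a - 1ℤ + b ≡ lo + (a + b) - 1ℤ
  shift = solve-∀
  swap : ∀ lo a b → lo + a - 1ℤ + b ≡ lo + a + b - 1ℤ
  swap = solve-∀
  cancel-1 : ∀ lo a → lo + a ≡ lo + a - 1ℤ + 1ℤ
  cancel-1 = solve-∀

intervalSum-cong : ∀ f g lo hi → (∀ l → lo ≤ l → l ≤ hi → f l ≡ g l) →
  intervalSum f lo hi ≡ intervalSum g lo hi
intervalSum-cong f g lo hi agree with ≤-total lo (hi + 1ℤ)
... | inj₂ hi<lo = trans (intervalSum-empty f lo hi hi<lo) (sym (intervalSum-empty g lo hi hi<lo))
... | inj₁ lo≤hi+1 with intervalSum-asRun lo≤hi+1
...   | len , hi≡ = begin
  intervalSum f lo hi  ≡⟨ intervalSum-run f lo len hi hi≡ ⟩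
  sumFrom f lo len     ≡⟨ sumFrom-cong f g lo len (λ t t<len → agree _ (i≤i+j lo (+ t)) (inside t t<len)) ⟩
  sumFrom g lo len     ≡⟨ sym (intervalSum-run g lo len hi hi≡) ⟩
  intervalSum g lo hi  ∎
  where
  step : ∀ lo t → lo + (1ℤ + t) ≡ lo + t + 1ℤ
  step = solve-∀
  last : ∀ lo len → lo + len ≡ lo + len - 1ℤ + 1ℤ
  last = solve-∀
  -- lo + t + 1 ≤ lo + len = hi + 1
  inside : ∀ t → t ℕ.< len → lo + + t ≤ hi
  inside t t<len = +1-cancel-≤
    (subst₂ _≤_ (step lo (+ t)) (trans (last lo (+ len)) (cong (_+ 1ℤ) (sym hi≡)))
            (+-monoʳ-≤ lo (+≤+ t<len)))

intervalSum-zero : ∀ f lo hi → (∀ l → lo ≤ l → l ≤ hi → f l ≡ 0ℤ) →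
  intervalSum f lo hi ≡ 0ℤ
intervalSum-zero f lo hi vanish =
  trans (intervalSum-cong f (λ _ → 0ℤ) lo hi vanish) (sumFrom-zero lo ∣ hi - lo + 1ℤ ⊔ 0ℤ ∣)

-- The lower end of a sum may be moved down over a region where the summand
-- vanishes; b ≤ p + 1 keeps the new interval from being "negatively long".
intervalSum-extendˡ : ∀ g L b p → (∀ l → l < L → g l ≡ 0ℤ) → b ≤ L → b ≤ p + 1ℤ →
  intervalSum g L p ≡ intervalSum g b p
intervalSum-extendˡ g L b p vanish b≤L b≤p+1 with ≤-total (p + 1ℤ) L
... | inj₁ p<L = begin
  intervalSum g L p  ≡⟨ intervalSum-empty g L p p<L ⟩
  0ℤ                 ≡⟨ sym (intervalSum-zero g b p λ l _ l≤p → vanish l (+1≤⇒< (≤-trans (+-monoˡ-≤ 1ℤ l≤p) p<L))) ⟩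
  intervalSum g b p  ∎
... | inj₂ L≤p+1 = sym (begin
  intervalSum g b p
    ≡⟨ intervalSum-split g b (L - 1ℤ) p (subst (b ≤_) L≡ b≤L) (+1-cancel-≤ (subst (_≤ p + 1ℤ) L≡ L≤p+1)) ⟩
  intervalSum g b (L - 1ℤ) + intervalSum g (L - 1ℤ + 1ℤ) p
    ≡⟨ cong₂ _+_ (intervalSum-zero g b (L - 1ℤ) λ l _ l≤L-1 → vanish l (+1≤⇒< (subst (l + 1ℤ ≤_) (sym L≡) (+-monoˡ-≤ 1ℤ l≤L-1))))
                 (cong (λ z → intervalSum g z p) (sym L≡)) ⟩
  0ℤ + intervalSum g L p
    ≡⟨ +-identityˡ _ ⟩
  intervalSum g L p
    ∎)
  where
  x≡x-1+1 : ∀ x → x ≡ x - 1ℤ + 1ℤ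
  x≡x-1+1 = solve-∀
  L≡ : L ≡ L - 1ℤ + 1ℤ
  L≡ = x≡x-1+1 L

intervalSum-truncate : ∀ g f b p M → (∀ l → l ≤ M → g l ≡ f l) → (∀ l → M < l → g l ≡ 0ℤ) →
  b ≤ p + 1ℤ → b ≤ M + 1ℤ →
  intervalSum g b p + intervalSum g (p + 1ℤ) M ≡ intervalSum f b M
intervalSum-truncate g f b p M agree vanish b≤p+1 b≤M+1 with ≤-total p M
... | inj₁ p≤M = begin
  intervalSum g b p + intervalSum g (p + 1ℤ) M  ≡⟨ sym (intervalSum-split g b p M b≤p+1 p≤M) ⟩
  intervalSum g b M                             ≡⟨ intervalSum-cong g f b M (λ l _ l≤M → agree l l≤M) ⟩
  intervalSum f b M                             ∎
... | inj₂ M≤p = begin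
  intervalSum g b p + intervalSum g (p + 1ℤ) M
    ≡⟨ cong₂ _+_ (intervalSum-split g b M p b≤M+1 M≤p) (intervalSum-empty g (p + 1ℤ) M (+-monoˡ-≤ 1ℤ M≤p)) ⟩
  (intervalSum g b M + intervalSum g (M + 1ℤ) p) + 0ℤ
    ≡⟨ cong (λ z → (intervalSum g b M + z) + 0ℤ) (intervalSum-zero g (M + 1ℤ) p λ l M+1≤l _ → vanish l (+1≤⇒< M+1≤l)) ⟩
  (intervalSum g b M + 0ℤ) + 0ℤ
    ≡⟨ trans (+-identityʳ _) (+-identityʳ _) ⟩
  intervalSum g b M
    ≡⟨ intervalSum-cong g f b M (λ l _ l≤M → agree l l≤M) ⟩
  intervalSum f b M
    ∎

module Residues (n : ℕ) .{{_ : NonZero n}} where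

  N : ℤ
  N = + n

  quotient-maximal : ∀ r r' q q' → r ℕ.< n → + r + q * N ≡ + r' + q' * N → ¬ (q < q')
  quotient-maximal r r' q q' r<n same q<q' with ≤⇒gap (<⇒+1≤ q<q')
  ... | d , q'≡ = NP.<⇒≱ r<n (NP.≤-trans (NP.m≤n+m n r') (NP.≤-trans (NP.m≤m+n (r' ℕ.+ n) (d ℕ.* n))
                     (NP.≤-reflexive (sym (+-injective r≡)))))
    where
    cancel : ∀ r q N → r ≡ (r + q * N) - q * N
    cancel = solve-∀
    expand : ∀ r' q d N → (r' + (q + 1ℤ + d) * N) - q * N ≡ r' + N + d * N
    expand = solve-∀
    r≡ : + r ≡ + (r' ℕ.+ n ℕ.+ d ℕ.* n)
    r≡ = begin
      + r                             ≡⟨ cancel (+ r) q N ⟩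
      (+ r + q * N) - q * N           ≡⟨ cong (λ z → z - q * N) (trans same (cong (λ z → + r' + z * N) q'≡)) ⟩
      (+ r' + (q + 1ℤ + + d) * N) - q * N ≡⟨ expand (+ r') q (+ d) N ⟩
      + r' + N + + d * N              ≡⟨ cong (λ z → + r' + N + z) (sym (pos-* d n)) ⟩
      + (r' ℕ.+ n ℕ.+ d ℕ.* n)        ∎

  %ℕ-unique : ∀ x r q → r ℕ.< n → x ≡ + r + q * N → x %ℕ n ≡ r
  %ℕ-unique x r q r<n x≡ with <-cmp q (x /ℕ n)
  ... | tri< q<q' _ _ = ⊥-elim (quotient-maximal r (x %ℕ n) q (x /ℕ n) r<n (trans (sym x≡) (a≡a%ℕn+[a/ℕn]*n x n)) q<q')
  ... | tri> _ _ q'<q = ⊥-elim (quotient-maximal (x %ℕ n) r (x /ℕ n) q (n%ℕd<d x n) (trans (sym (a≡a%ℕn+[a/ℕn]*n x n)) x≡) q'<q)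
  ... | tri≈ _ q≡q' _ = +-injective (begin
    + (x %ℕ n)                          ≡⟨ cancel (+ (x %ℕ n)) q N ⟩
    (+ (x %ℕ n) + q * N) - q * N        ≡⟨ cong (λ z → (+ (x %ℕ n) + z * N) - q * N) q≡q' ⟩
    (+ (x %ℕ n) + x /ℕ n * N) - q * N   ≡⟨ cong (λ z → z - q * N) (sym (a≡a%ℕn+[a/ℕn]*n x n)) ⟩
    x - q * N                           ≡⟨ cong (λ z → z - q * N) x≡ ⟩
    (+ r + q * N) - q * N               ≡⟨ sym (cancel (+ r) q N) ⟩
    + r                                 ∎)
    where
    cancel : ∀ r q N → r ≡ (r + q * N) - q * N
    cancel = solve-∀

module Periodic (n : ℕ) .{{_ : NonZero n}} (a : Fin n → ℕ) where
  open Residues n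

  aAt-rep : ∀ l r q (r<n : r ℕ.< n) → l ≡ + r + q * N → aAt n a l ≡ + a (fromℕ< r<n)
  aAt-rep l r q r<n l≡ = cong (λ t → + a t) (FP.fromℕ<-cong _ _ (%ℕ-unique l r q r<n l≡) _ _)

  aAt-offset : ∀ q (t : Fin n) → aAt n a (q * N + + toℕ t) ≡ + a t
  aAt-offset q t = trans (aAt-rep _ (toℕ t) q (FP.toℕ<n t) (+-comm (q * N) (+ toℕ t)))
                         (cong (λ u → + a u) (FP.fromℕ<-toℕ t _))

  aAt-periodic : ∀ l → aAt n a (l + N) ≡ aAt n a l
  aAt-periodic l = aAt-rep (l + N) (l %ℕ n) (l /ℕ n + 1ℤ) (n%ℕd<d l n)
    (trans (cong (_+ N) (a≡a%ℕn+[a/ℕn]*n l n)) (next-quotient (+ (l %ℕ n)) (l /ℕ n) N))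
    where
    next-quotient : ∀ r q N → r + q * N + N ≡ r + (q + 1ℤ) * N
    next-quotient = solve-∀

  periodSum : ∀ q → intervalSum (aAt n a) (q * N + 1ℤ) (q * N + N) ≡ + kk n a
  periodSum q = begin
    intervalSum (aAt n a) (q * N + 1ℤ) (q * N + N)
      ≡⟨ intervalSum-run (aAt n a) (q * N + 1ℤ) n (q * N + N) (last (q * N) N) ⟩
    sumFrom (aAt n a) (q * N + 1ℤ) n
      ≡⟨ sumFrom-rotate (aAt n a) (q * N) n (aAt-periodic (q * N)) ⟩
    sumFrom (aAt n a) (q * N) n
      ≡⟨ sumFrom-finSum n a (aAt n a) (q * N) (aAt-offset q) ⟩
    + kk n a
      ∎
    where
    last : ∀ c N → c + N ≡ c + 1ℤ + N - 1ℤ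
    last = solve-∀

  T-below : ∀ m l → l ≤ m * N → T n a m l ≡ aAt n a l
  T-below m l l≤mn with l ≤? m * N
  ... | yes _    = refl
  ... | no  l≰mn = ⊥-elim (l≰mn l≤mn)

  T-above : ∀ m l → m * N < l → T n a m l ≡ 0ℤ
  T-above m l mn<l with l ≤? m * N
  ... | yes l≤mn = ⊥-elim (<⇒≱ mn<l l≤mn)
  ... | no  _    = refl

module Pattern (n : ℕ) .{{_ : NonZero n}} (a : Fin n → ℕ) (A : ℤ → ℤ) (h : InΠ n a A) where
  open InΠ h
  open Residues n
  open Periodic n a

  -- cut i j = in + j(n-1) ends the A-sum of s_{i,j}; top i j = (i+j)n ends its T-sum.
  cut top : ℤ → ℤ → ℤ
  cut i j = i * N + j * (N - 1ℤ)
  top i j = (i + j) * N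

  D : ℤ → ℤ → ℤ → ℤ
  D b p M = intervalSum A b p - intervalSum (aAt n a) b M

  -- Below this bound every start b of D computes s (see s-normal).
  start : ℤ → ℤ → ℤ
  start p M = lower ⊓ (M ⊓ (p + 1ℤ))

  start-mono : ∀ {p p' M M'} → p ≤ p' → M ≤ M' → start p M ≤ start p' M'
  start-mono p≤p' M≤M' = ⊓-mono-≤ ≤-refl (⊓-mono-≤ M≤M' (+-monoˡ-≤ 1ℤ p≤p'))

  start≤lower : ∀ p M → start p M ≤ lower
  start≤lower p M = i⊓j≤i lower _

  start≤top : ∀ p M → start p M ≤ M
  start≤top p M = ≤-trans (i⊓j≤j lower _) (i⊓j≤i M _)

  start≤cut+1 : ∀ p M → start p M ≤ p + 1ℤ
  start≤cut+1 p M = ≤-trans (i⊓j≤j lower _) (i⊓j≤j M _)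

  s-normal : ∀ i j b → b ≤ start (cut i j) (top i j) → s n a h i j ≡ D b (cut i j) (top i j)
  s-normal i j b b≤start = begin
    intervalSum g (lower ⊓ M) p - intervalSum T′ (p + 1ℤ) M
      ≡⟨ cong (_- intervalSum T′ (p + 1ℤ) M) (intervalSum-extendˡ g (lower ⊓ M) b p vanish b≤L b≤p+1) ⟩
    intervalSum g b p - intervalSum T′ (p + 1ℤ) M
      ≡⟨ cong (_- intervalSum T′ (p + 1ℤ) M) (intervalSum-sub A T′ b p) ⟩
    (intervalSum A b p - intervalSum T′ b p) - intervalSum T′ (p + 1ℤ) M
      ≡⟨ sub-sub (intervalSum A b p) (intervalSum T′ b p) (intervalSum T′ (p + 1ℤ) M) ⟩
    intervalSum A b p - (intervalSum T′ b p + intervalSum T′ (p + 1ℤ) M)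
      ≡⟨ cong (intervalSum A b p -_) (intervalSum-truncate T′ (aAt n a) b p M (T-below (i + j)) (T-above (i + j)) b≤p+1 b≤M+1) ⟩
    D b p M
      ∎
    where
    p = cut i j
    M = top i j
    T′ = T n a (i + j)
    g : ℤ → ℤ
    g l = A l - T′ l
    b≤M : b ≤ M
    b≤M = ≤-trans b≤start (start≤top p M)
    b≤L : b ≤ lower ⊓ M
    b≤L = ⊓-glb (≤-trans b≤start (start≤lower p M)) b≤M
    b≤p+1 : b ≤ p + 1ℤ
    b≤p+1 = ≤-trans b≤start (start≤cut+1 p M)
    b≤M+1 : b ≤ M + 1ℤ
    b≤M+1 = ≤-trans b≤M (i≤i+j M 1ℤ)
    -- far to the left A coincides with T^{i+j}, both being a_{l mod n}
    vanish : ∀ l → l < lower ⊓ M → g l ≡ 0ℤ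
    vanish l l<L = trans (cong₂ _-_ (below l (<-≤-trans l<L (i⊓j≤i lower M)))
                                     (T-below (i + j) l (<⇒≤ (<-≤-trans l<L (i⊓j≤j lower M)))))
                         (+-inverseʳ (aAt n a l))
    sub-sub : ∀ x y z → (x - y) - z ≡ x - (y + z)
    sub-sub = solve-∀

  D-period : ∀ b p q → b ≤ p + 1ℤ → b ≤ q * N + 1ℤ →
    D b (p + N) (q * N + N) ≡ D b p (q * N) + (intervalSum A (p + 1ℤ) (p + N) - + kk n a)
  D-period b p q b≤p+1 b≤M+1 = begin
    intervalSum A b (p + N) - intervalSum (aAt n a) b (q * N + N)
      ≡⟨ cong₂ _-_ (intervalSum-split A b p (p + N) b≤p+1 (i≤i+j p N))
                   (intervalSum-split (aAt n a) b (q * N) (q * N + N) b≤M+1 (i≤i+j (q * N) N)) ⟩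
    (intervalSum A b p + W) - (intervalSum (aAt n a) b (q * N) + intervalSum (aAt n a) (q * N + 1ℤ) (q * N + N))
      ≡⟨ cong (λ z → (intervalSum A b p + W) - (intervalSum (aAt n a) b (q * N) + z)) (periodSum q) ⟩
    (intervalSum A b p + W) - (intervalSum (aAt n a) b (q * N) + + kk n a)
      ≡⟨ regroup (intervalSum A b p) (intervalSum (aAt n a) b (q * N)) W (+ kk n a) ⟩
    D b p (q * N) + (W - + kk n a)
      ∎
    where
    W = intervalSum A (p + 1ℤ) (p + N)
    regroup : ∀ x y w k → (x + w) - (y + k) ≡ (x - y) + (w - k)
    regroup = solve-∀

  D-one : ∀ b p M → b ≤ p + 1ℤ → D b (p + 1ℤ) M ≡ D b p M + A (p + 1ℤ)
  D-one b p M b≤p+1 = begin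
    intervalSum A b (p + 1ℤ) - intervalSum (aAt n a) b M
      ≡⟨ cong (_- intervalSum (aAt n a) b M)
              (trans (intervalSum-split A b p (p + 1ℤ) b≤p+1 (i≤i+j p 1ℤ))
                     (cong (λ z → intervalSum A b p + z) (intervalSum-single A (p + 1ℤ)))) ⟩
    (intervalSum A b p + A (p + 1ℤ)) - intervalSum (aAt n a) b M
      ≡⟨ regroup (intervalSum A b p) (intervalSum (aAt n a) b M) (A (p + 1ℤ)) ⟩
    D b p M + A (p + 1ℤ)
      ∎
    where
    regroup : ∀ x y w → (x + w) - y ≡ (x - y) + w
    regroup = solve-∀

  s-step-i : ∀ i j →
    s n a h (i + 1ℤ) j ≡ s n a h i j + (intervalSum A (cut i j + 1ℤ) (cut i j + N) - + kk n a)
  s-step-i i j = begin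
    s n a h (i + 1ℤ) j              ≡⟨ s-normal (i + 1ℤ) j b b≤start′ ⟩
    D b (cut (i + 1ℤ) j) (top (i + 1ℤ) j) ≡⟨ cong₂ (D b) (cut-next i j N) (top-next i j N) ⟩
    D b (p + N) ((i + j) * N + N)   ≡⟨ D-period b p (i + j) (start≤cut+1 p M) (≤-trans (start≤top p M) (i≤i+j M 1ℤ)) ⟩
    D b p M + excess                ≡⟨ cong (_+ excess) (sym (s-normal i j b ≤-refl)) ⟩
    s n a h i j + excess            ∎
    where
    p = cut i j
    excess = intervalSum A (p + 1ℤ) (p + N) - + kk n a
    M = top i j
    b = start p M
    cut-next : ∀ i j N → (i + 1ℤ) * N + j * (N - 1ℤ) ≡ (i * N + j * (N - 1ℤ)) + N
    cut-next = solve-∀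
    top-next : ∀ i j N → (i + 1ℤ + j) * N ≡ (i + j) * N + N
    top-next = solve-∀
    b≤start′ : b ≤ start (cut (i + 1ℤ) j) (top (i + 1ℤ) j)
    b≤start′ = subst₂ (λ x y → b ≤ start x y) (sym (cut-next i j N)) (sym (top-next i j N))
                      (start-mono (i≤i+j p N) (i≤i+j M N))

  s-step-j : ∀ i j → s n a h (i + 1ℤ) j ≡ s n a h i (j + 1ℤ) + A (cut i (j + 1ℤ) + 1ℤ)
  s-step-j i j = begin
    s n a h (i + 1ℤ) j              ≡⟨ s-normal (i + 1ℤ) j b b≤start′ ⟩
    D b (cut (i + 1ℤ) j) (top (i + 1ℤ) j) ≡⟨ cong₂ (D b) (cut-next i j N) (top-next i j N) ⟩
    D b (q + 1ℤ) M                  ≡⟨ D-one b q M (start≤cut+1 q M) ⟩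
    D b q M + A (q + 1ℤ)            ≡⟨ cong (_+ A (q + 1ℤ)) (sym (s-normal i (j + 1ℤ) b ≤-refl)) ⟩
    s n a h i (j + 1ℤ) + A (q + 1ℤ) ∎
    where
    q = cut i (j + 1ℤ)
    M = top i (j + 1ℤ)
    b = start q M
    cut-next : ∀ i j N → (i + 1ℤ) * N + j * (N - 1ℤ) ≡ (i * N + (j + 1ℤ) * (N - 1ℤ)) + 1ℤ
    cut-next = solve-∀
    top-next : ∀ i j N → (i + 1ℤ + j) * N ≡ (i + (j + 1ℤ)) * N
    top-next = solve-∀
    b≤start′ : b ≤ start (cut (i + 1ℤ) j) (top (i + 1ℤ) j)
    b≤start′ = subst₂ (λ x y → b ≤ start x y) (sym (cut-next i j N)) (sym (top-next i j N))
                      (start-mono (i≤i+j q 1ℤ) ≤-refl)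

  window-bound : ∀ p → intervalSum A (p + 1ℤ) (p + N) ≤ + kk n a
  window-bound p = subst (λ x → intervalSum A x (p + N) ≤ + kk n a) (back p N) (window (p + N))
    where
    back : ∀ p N → p + N - N + 1ℤ ≡ p + 1ℤ
    back = solve-∀

  s-antitone-i : ∀ i j → s n a h i j ≥ s n a h (i + 1ℤ) j
  s-antitone-i i j = subst₂ _≤_ (sym (s-step-i i j)) (+-identityʳ (s n a h i j))
    (+-monoʳ-≤ (s n a h i j) (i≤j⇒i-j≤0 (window-bound (cut i j))))

  s-monotone-j : ∀ i j → s n a h (i + 1ℤ) j ≥ s n a h i (j + 1ℤ)
  s-monotone-j i j = subst₂ _≤_ (+-identityʳ (s n a h i (j + 1ℤ))) (sym (s-step-j i j))
    (+-monoʳ-≤ (s n a h i (j + 1ℤ)) (nonneg _))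

proposition1 : (n : ℕ) .{{_ : NonZero n}} → 2 ℕ.≤ n → (a : Fin n → ℕ) →
    ¬ (∀ t → a t ≡ 0) → (A : ℤ → ℤ) → (h : InΠ n a A) → (i j : ℤ) →
    (s n a h i j ≥ s n a h (i + 1ℤ) j) × (s n a h (i + 1ℤ) j ≥ s n a h i (j + 1ℤ))
proposition1 n _ a _ A h i j = s-antitone-i i j , s-monotone-j i j
  where open Pattern n a A h
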